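{- Let $\mathscr{M}$ be a conic minion, let $2\leq k\in\mathbb{N}$, let $\mathbf{X},\mathbf{A}$ be digraphs, and suppose that there exists a $(2k)$-tensorial homomorphism from $\mathbf{X}^{\otimes 2k}$ to $\mathbb{F}_{\mathscr{M}}(\mathbf{A}^{\otimes 2k})$ and $E(\delta\mathbf{A})\neq\emptyset$. Then there exists a $k$-tensorial homomorphism from $(\delta\mathbf{X})^{\otimes k}$ to $\mathbb{F}_{\mathscr{M}}((\delta\mathbf{A})^{\otimes k})$.
   Context: A digraph $\mathbf{X}$ has vertex set $V(\mathbf{X})$ and edge set $E(\mathbf{X})\subseteq V(\mathbf{X})^2$. The line digraph $\delta\mathbf{X}$ has $V(\delta\mathbf{X})=E(\mathbf{X})$ and $E(\delta\mathbf{X})=\{((x,y),(y,z)):(x,y),(y,z)\in E(\mathbf{X})\}$. For $\pi:[\ell]\to[m]$, $P_\pi$ is the $m\times\ell$ matrix whose $(i,j)$-entry is $1$ if $\pi(j)=i$ and $0$ otherwise. A linear minion $\mathscr{M}$ of depth $d$ is a union of sets $\mathscr{M}^{(\ell)}$ ($\ell\in\mathbb{N}$) of $\ell\times d$ rational matrices such that $P_\pi M\in\mathscr{M}^{(m)}$ whenever $M\in\mathscr{M}^{(\ell)}$ and $\pi:[\ell]\to[m]$. It is conic if it contains no all-zero matrix and, for every $M\in\mathscr{M}^{(\ell)}$ and $V\subseteq[\ell]$, if the sum of the rows of $M$ indexed by $V$ is the zero vector then each of those rows is zero. For a $p$-uniform hypergraph $\mathbf{H}$ with $n$ vertices and $m$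 hyperedges, the free structure $\mathbb{F}_{\mathscr{M}}(\mathbf{H})$ is the $p$-uniform hypergraph with vertex set $\mathscr{M}^{(n)}$ in which $(M_1,\dots,M_p)$ is a hyperedge iff there is $Q\in\mathscr{M}^{(m)}$ with $M_i=P_{\pi_i}Q$ for all $i$, where $\pi_i:E(\mathbf{H})\to V(\mathbf{H})$ sends a hyperedge to its $i$-th entry. The $k$-th tensor power $\mathbf{A}^{\otimes k}$ of a digraph $\mathbf{A}$ is the $2^k$-uniform hypergraph with vertex set $V(\mathbf{A})^k$ and hyperedges $\vec{a}^{\otimes k}$ for $\vec{a}\in E(\mathbf{A})$, where $\vec{a}^{\otimes k}$ is the $2\times\cdots\times 2$ ($k$ modes) array whose $\vec{i}$-th entry is $\vec{a}_{\vec{i}}=(a_{i_1},\dots,a_{i_k})$ for $\vec{i}\in[2]^k$. Identifying $V(\mathbf{A})$ with $[n]$, vertices of $\mathbb{F}_{\mathscr{M}}(\mathbf{A}^{\otimes k})$ are viewed as arrays indexed by $[n]^k\times[d]$. A homomorphism $\xi:\mathbf{X}^{\otimes k}\to\mathbb{F}_{\mathscr{M}}(\mathbf{A}^{\otimes k})$ is $k$-tensorial if for all $\vec{x}\in V(\mathbf{X})^k$ and $\vec{i}\in[k]^k$, $\xi(\vec{x}_{\vec{i}})$ equals the projection of $\xi(\vec{x})$ onto $\vec{i}$, i.e. for each $\vec{a}\in[n]^k$ the $\vec{a}$-th row of $\xi(\vec{x}_{\vec{i}})$ equals $\sum_{\vec{b}\in[n]^k,\ \vec{b}_{\vec{i}}=\vec{a}}$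 (the $\vec{b}$-th row of $\xi(\vec{x})$). -}

module Defs where

open import Data.Nat using (ℕ; zero; suc; _^_)
open import Data.Fin using (Fin; zero; suc; combine; _≟_)
open import Data.Bool using (Bool; T)
open import Data.Product using (_×_; _,_; proj₁; proj₂; Σ; ∃)
open import Data.List as L using (List; []; _∷_; length; filterᵇ; concatMap; allFin)
open import Data.Vec as V using (Vec; []; _∷_; tabulate; replicate; zipWith)
open import Data.Vec.Properties using (≡-dec)
open import Data.Rational using (ℚ; 0ℚ; _+_)
open import Relation.Nullary using (¬_; does)
open import Relation.Binary.PropositionalEquality using (_≡_)

Matrix : ℕ → ℕ → Set
Matrix ℓ d = Vec (Vec ℚ d) ℓ

zeroRow : (d : ℕ) → Vec ℚ d
zeroRow d = replicate d 0ℚ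

rowSum : {d : ℕ} → List (Vec ℚ d) → Vec ℚ d
rowSum {d} = L.foldr (zipWith _+_) (zeroRow d)

P : {ℓ m d : ℕ} → (Fin ℓ → Fin m) → Matrix ℓ d → Matrix m d
P {ℓ} π M = tabulate λ i →
  rowSum (L.map (V.lookup M) (filterᵇ (λ j → does (π j ≟ i)) (allFin ℓ)))

record LinearMinion (d : ℕ) : Set₁ where
  field
    Mem    : (ℓ : ℕ) → Matrix ℓ d → Set
    closed : {ℓ m : ℕ} (π : Fin ℓ → Fin m) (M : Matrix ℓ d) →
             Mem ℓ M → Mem m (P π M)
open LinearMinion public

Conic : {d : ℕ} → LinearMinion d → Set
Conic {d} 𝓜 =
  ((ℓ : ℕ) (M : Matrix ℓ d) → Mem 𝓜 ℓ M → ¬ (M ≡ replicate ℓ (zeroRow d))) ×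
  ((ℓ : ℕ) (M : Matrix ℓ d) → Mem 𝓜 ℓ M → (S : Fin ℓ → Bool) →
     rowSum (L.map (V.lookup M) (filterᵇ S (allFin ℓ))) ≡ zeroRow d →
     (j : Fin ℓ) → T (S j) → V.lookup M j ≡ zeroRow d)

record Digraph : Set where
  field
    n    : ℕ
    edge : Fin n → Fin n → Bool
open Digraph public

allPairs : (n : ℕ) → List (Fin n × Fin n)
allPairs n = concatMap (λ a → L.map (a ,_) (allFin n)) (allFin n)

-- E(X), enumerated in lexicographic order
edges : (X : Digraph) → List (Fin (n X) × Fin (n X))
edges X = filterᵇ (λ p → edge X (proj₁ p) (proj₂ p)) (allPairs (n X))

#E : Digraph → ℕ
#E X = length (edges X)

edgeAt : (X : Digraph) → Fin (#E X) → Fin (n X) × Fin (n X)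
edgeAt X = L.lookup (edges X)

-- line digraph: vertices are the edges of X (via the enumeration edgeAt)
δ : Digraph → Digraph
δ X = record
  { n    = #E X
  ; edge = λ e f → does (proj₂ (edgeAt X e) ≟ proj₁ (edgeAt X f)) }

-- Finite hypergraphs whose hyperedges are tuples indexed by a type I
-- (for the tensor power, I = [2]^k, identified with the 2^k positions).

record Hypergraph (I : Set) : Set where
  field
    nV  : ℕ
    nE  : ℕ
    ent : Fin nE → I → Fin nV
open Hypergraph public

-- fixed bijection [n]^k ≅ [n^k] (mixed-radix encoding)
enc : {n k : ℕ} → Vec (Fin n) k → Fin (n ^ k)
enc []       = zero
enc (x ∷ xs) = combine x (enc xs)

allVecs : (n k : ℕ) → List (Vec (Fin n) k)
allVecs n zero    = [] ∷ []
allVecs n (suc k) = concatMap (λ x → L.map (x ∷_) (allVecs n k)) (allFin n)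

sel : {A : Set} → A × A → Fin 2 → A
sel (a , b) zero    = a
sel (a , b) (suc _) = b

-- tensor power A^{⊗k}: vertices [n]^k (encoded), hyperedges a^{⊗k} for a ∈ E(A)
_⊗_ : Digraph → (k : ℕ) → Hypergraph (Vec (Fin 2) k)
A ⊗ k = record
  { nV  = n A ^ k
  ; nE  = #E A
  ; ent = λ e i → enc (V.map (sel (edgeAt A e)) i) }

-- (Ms i)_{i ∈ I} is a hyperedge of 𝔽_𝓜(H)
FreeEdge : {d : ℕ} {I : Set} (𝓜 : LinearMinion d) (H : Hypergraph I) →
           (I → Matrix (nV H) d) → Set
FreeEdge {d} 𝓜 H Ms =
  Σ (Matrix (nE H) d) λ Q → Mem 𝓜 (nE H) Q ×
    ((i : _) → Ms i ≡ P (λ e → ent H e i) Q)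

IsFreeHom : {d : ℕ} {I : Set} (𝓜 : LinearMinion d) (G H : Hypergraph I) →
            (Fin (nV G) → Matrix (nV H) d) → Set
IsFreeHom 𝓜 G H f =
  ((v : Fin (nV G)) → Mem 𝓜 (nV H) (f v)) ×
  ((e : Fin (nE G)) → FreeEdge 𝓜 H (λ i → f (ent G e i)))

-- projection of an [n]^k × d array onto ī ∈ [k]^k, evaluated at row ā
projRow : {d nA k : ℕ} → Matrix (nA ^ k) d → Vec (Fin k) k → Vec (Fin nA) k → Vec ℚ d
projRow {d} {nA} {k} M is a =
  rowSum (L.map (λ b → V.lookup M (enc b))
    (filterᵇ (λ b → does (≡-dec _≟_ (V.map (V.lookup b) is) a)) (allVecs nA k)))

IsTensorial : {d : ℕ} (k : ℕ) (X A : Digraph) →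
              (Fin (n X ^ k) → Matrix (n A ^ k) d) → Set
IsTensorial k X A f =
  (x : Vec (Fin (n X)) k) (is : Vec (Fin k) k) (a : Vec (Fin (n A)) k) →
    V.lookup (f (enc (V.map (V.lookup x) is))) (enc a) ≡ projRow (f (enc x)) is a

TensorialHom : {d : ℕ} (𝓜 : LinearMinion d) (k : ℕ) (X A : Digraph) → Set
TensorialHom {d} 𝓜 k X A =
  Σ (Fin (n X ^ k) → Matrix (n A ^ k) d) λ f →
    IsFreeHom 𝓜 (X ⊗ k) (A ⊗ k) f × IsTensorial k X A f

HasEdge : Digraph → Set
HasEdge X = ∃ λ (a : Fin (n X)) → ∃ λ (b : Fin (n X)) → T (edge X a b)

-- Let ξ be the given (2k)-tensorial homomorphism and read a k-tuple of edges
-- of X as the 2k-tuple of their endpoints (tails in the first k positions,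
-- heads in the last k).  Define f(x̄) by pushing ξ(endpoints x̄) forward along
-- the map [n_A]^{2k} → E(A)^k that reads the k pairs (b_j , b_{k+j}) as edges of A
-- (non-edges go to a fixed default edge).  Pairing positions commutes with
-- projections, so f is k-tensorial.  A hyperedge of (δX)^{⊗k} comes from a
-- path e₁ e₂ in δX, and each of its entries is a projection of the single
-- vertex (e₁, e₂, …, e₂); so it suffices that the rows of f(e₁, e₂, …, e₂) are
-- supported on tuples whose first two entries form an edge of δA.  This
-- support condition holds for the rows of ξ(endpoints): conicity kills the
-- rows that do not carry an A-edge where the X-tuple carries an X-edge
-- (here k ≥ 2 is used), and tensoriality alone kills the rows that are not
-- constant where the X-tuple is constant (the common vertex of e₁ and e₂).
module Submission where

open import Defs
open import Data.Bool using (Bool; true; false; T; if_then_else_)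
open import Data.Bool.Properties using (T?; T-≡)
open import Data.Empty using (⊥-elim)
open import Data.Fin using (Fin; zero; suc; _≟_; combine; remQuot; splitAt; _↑ˡ_; _↑ʳ_)
import Data.Fin.Properties as FinP
open import Data.List as L using (List; []; _∷_; _++_; allFin; filterᵇ; concatMap)
import Data.List.Properties as LP
open import Data.List.Membership.Propositional using (_∈_)
open import Data.List.Membership.Propositional.Properties
  using (∈-filter⁺; ∈-filter⁻; ∈-lookup; ∈-allFin; ∈-concatMap⁺; ∈-map⁺)
import Data.List.Relation.Unary.Any as Any
open import Data.List.Relation.Unary.Any.Properties using (lookup-index)
open import Data.Nat using (ℕ; zero; suc; _+_; _*_; _^_; _≤_; s≤s; z≤n)
open import Data.Product using (_×_; _,_; proj₁; proj₂; Σ)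
import Data.Product.Properties as ProdP
open import Data.Rational using (ℚ)
import Data.Rational as ℚ
import Data.Rational.Properties as ℚP
open import Data.Sum using (_⊎_; inj₁; inj₂; [_,_]′)
open import Data.Vec as V using (Vec; []; _∷_; lookup; tabulate; replicate)
import Data.Vec.Properties as VP
open import Function using (_∘_; id; Equivalence)
open import Function.Bundles using (mk⇔)
open import Relation.Nullary using (Dec; yes; no; does; ¬_)
open import Relation.Nullary.Decidable using (dec-true; does-⇔)
open import Relation.Binary.PropositionalEquality

T-does : {B : Set} (b? : Dec B) → B → T (does b?)
T-does b? b = Equivalence.from T-≡ (dec-true b? b)

does-T : {B : Set} (b? : Dec B) → T (does b?) → B
does-T (yes b) _ = b

lookup-ext : {B : Set} {m : ℕ} {u v : Vec B m} → (∀ i → lookup u i ≡ lookup v i) → u ≡ v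
lookup-ext {u = u} {v} h = trans (sym (VP.tabulate∘lookup u)) (trans (VP.tabulate-cong h) (VP.tabulate∘lookup v))

-- Row sums and the matrices P_π

module _ {d : ℕ} where

  infixl 6 _⊕_

  _⊕_ : Vec ℚ d → Vec ℚ d → Vec ℚ d
  _⊕_ = V.zipWith ℚ._+_

  𝟎 : Vec ℚ d
  𝟎 = zeroRow d

  ⊕-assoc : ∀ a b c → (a ⊕ b) ⊕ c ≡ a ⊕ (b ⊕ c)
  ⊕-assoc = VP.zipWith-assoc ℚP.+-assoc

  ⊕-comm : ∀ a b → a ⊕ b ≡ b ⊕ a
  ⊕-comm = VP.zipWith-comm ℚP.+-comm

  ⊕-identityˡ : ∀ a → 𝟎 ⊕ a ≡ a
  ⊕-identityˡ = VP.zipWith-identityˡ ℚP.+-identityˡ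

  ⊕-identityʳ : ∀ a → a ⊕ 𝟎 ≡ a
  ⊕-identityʳ = VP.zipWith-identityʳ ℚP.+-identityʳ

  ⊕-interchange : ∀ a b c e → (a ⊕ b) ⊕ (c ⊕ e) ≡ (a ⊕ c) ⊕ (b ⊕ e)
  ⊕-interchange a b c e = begin
    (a ⊕ b) ⊕ (c ⊕ e) ≡⟨ ⊕-assoc a b (c ⊕ e) ⟩
    a ⊕ (b ⊕ (c ⊕ e)) ≡⟨ cong (a ⊕_) (sym (⊕-assoc b c e)) ⟩
    a ⊕ ((b ⊕ c) ⊕ e) ≡⟨ cong (λ z → a ⊕ (z ⊕ e)) (⊕-comm b c) ⟩
    a ⊕ ((c ⊕ b) ⊕ e) ≡⟨ cong (a ⊕_) (⊕-assoc c b e) ⟩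
    a ⊕ (c ⊕ (b ⊕ e)) ≡⟨ sym (⊕-assoc a c (b ⊕ e)) ⟩
    (a ⊕ c) ⊕ (b ⊕ e) ∎
    where open ≡-Reasoning

  ∑ : {B : Set} → List B → (B → Vec ℚ d) → Vec ℚ d
  ∑ xs g = rowSum (L.map g xs)

  ∑-cong : {B : Set} (xs : List B) {g h : B → Vec ℚ d} → (∀ x → g x ≡ h x) → ∑ xs g ≡ ∑ xs h
  ∑-cong []       _ = refl
  ∑-cong (x ∷ xs) e = cong₂ _⊕_ (e x) (∑-cong xs e)

  ∑-⊕ : {B : Set} (xs : List B) (g h : B → Vec ℚ d) → ∑ xs (λ x → g x ⊕ h x) ≡ ∑ xs g ⊕ ∑ xs h
  ∑-⊕ []       g h = sym (⊕-identityˡ _)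
  ∑-⊕ (x ∷ xs) g h = trans (cong (g x ⊕ h x ⊕_) (∑-⊕ xs g h)) (⊕-interchange _ _ _ _)

  ∑-𝟎 : {B : Set} (xs : List B) → ∑ xs (λ _ → 𝟎) ≡ 𝟎
  ∑-𝟎 []       = refl
  ∑-𝟎 (x ∷ xs) = trans (cong (𝟎 ⊕_) (∑-𝟎 xs)) (⊕-identityˡ _)

  ∑-comm : {B C : Set} (xs : List B) (ys : List C) (g : B → C → Vec ℚ d) →
           ∑ xs (λ x → ∑ ys (g x)) ≡ ∑ ys (λ y → ∑ xs (λ x → g x y))
  ∑-comm []       ys g = sym (∑-𝟎 ys)
  ∑-comm (x ∷ xs) ys g =
    trans (cong (∑ ys (g x) ⊕_) (∑-comm xs ys g)) (sym (∑-⊕ ys (g x) (λ y → ∑ xs (λ x′ → g x′ y))))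

  ∑-map : {B C : Set} (f : B → C) (xs : List B) (g : C → Vec ℚ d) → ∑ (L.map f xs) g ≡ ∑ xs (g ∘ f)
  ∑-map f xs g = cong rowSum (sym (LP.map-∘ xs))

  ∑-allFin-suc : (m : ℕ) (g : Fin (suc m) → Vec ℚ d) → ∑ (allFin (suc m)) g ≡ g zero ⊕ ∑ (allFin m) (g ∘ suc)
  ∑-allFin-suc m g = cong (λ z → g zero ⊕ rowSum z)
    (trans (LP.map-tabulate suc g) (sym (LP.map-tabulate id (g ∘ suc))))

  keepIf : Bool → Vec ℚ d → Vec ℚ d
  keepIf b r = if b then r else 𝟎

  keepIf-𝟎 : (b : Bool) → keepIf b 𝟎 ≡ 𝟎
  keepIf-𝟎 true  = refl
  keepIf-𝟎 false = refl

  keepIf-comm : (a b : Bool) (r : Vec ℚ d) → keepIf a (keepIf b r) ≡ keepIf b (keepIf a r)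
  keepIf-comm true  b     r = refl
  keepIf-comm false true  r = refl
  keepIf-comm false false r = refl

  keepIf-∑ : {B : Set} (b : Bool) (xs : List B) (g : B → Vec ℚ d) → keepIf b (∑ xs g) ≡ ∑ xs (keepIf b ∘ g)
  keepIf-∑ true  xs g = refl
  keepIf-∑ false xs g = sym (∑-𝟎 xs)

  rowSum-filterᵇ : {B : Set} (xs : List B) (p : B → Bool) (g : B → Vec ℚ d) →
                   rowSum (L.map g (filterᵇ p xs)) ≡ ∑ xs (λ x → keepIf (p x) (g x))
  rowSum-filterᵇ []       p g = refl
  rowSum-filterᵇ (x ∷ xs) p g with p x
  ... | true  = cong (g x ⊕_) (rowSum-filterᵇ xs p g)
  ... | false = trans (rowSum-filterᵇ xs p g) (sym (⊕-identityˡ _))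

  ∑-keepIf-≟ : (m : ℕ) (t : Fin m) (h : Fin m → Vec ℚ d) →
               ∑ (allFin m) (λ y → keepIf (does (t ≟ y)) (h y)) ≡ h t
  ∑-keepIf-≟ (suc m) zero h = begin
    ∑ (allFin (suc m)) (λ y → keepIf (does (zero ≟ y)) (h y)) ≡⟨ ∑-allFin-suc m _ ⟩
    h zero ⊕ ∑ (allFin m) (λ _ → 𝟎)                          ≡⟨ cong (h zero ⊕_) (∑-𝟎 (allFin m)) ⟩
    h zero ⊕ 𝟎                                               ≡⟨ ⊕-identityʳ _ ⟩
    h zero                                                   ∎
    where open ≡-Reasoning
  ∑-keepIf-≟ (suc m) (suc t) h =
    trans (∑-allFin-suc m _) (trans (⊕-identityˡ _) (∑-keepIf-≟ m t (h ∘ suc)))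

  lookup-P : {ℓ m : ℕ} (π : Fin ℓ → Fin m) (M : Matrix ℓ d) (i : Fin m) →
             lookup (P π M) i ≡ ∑ (allFin ℓ) (λ j → keepIf (does (π j ≟ i)) (lookup M j))
  lookup-P {ℓ} π M i = trans (VP.lookup∘tabulate _ i) (rowSum-filterᵇ (allFin ℓ) _ _)

  P-∘ : {ℓ m o : ℕ} (π₁ : Fin ℓ → Fin m) (π₂ : Fin m → Fin o) (M : Matrix ℓ d) →
        P π₂ (P π₁ M) ≡ P (π₂ ∘ π₁) M
  P-∘ {ℓ} {m} {o} π₁ π₂ M = lookup-ext λ c → begin
    lookup (P π₂ (P π₁ M)) c
      ≡⟨ lookup-P π₂ (P π₁ M) c ⟩
    ∑ (allFin m) (λ y → keepIf (does (π₂ y ≟ c)) (lookup (P π₁ M) y))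
      ≡⟨ ∑-cong (allFin m) (λ y → trans (cong (keepIf (does (π₂ y ≟ c))) (lookup-P π₁ M y))
                                       (keepIf-∑ (does (π₂ y ≟ c)) (allFin ℓ) _)) ⟩
    ∑ (allFin m) (λ y → ∑ (allFin ℓ) (λ j → term c y j))
      ≡⟨ ∑-comm (allFin m) (allFin ℓ) (term c) ⟩
    ∑ (allFin ℓ) (λ j → ∑ (allFin m) (λ y → term c y j))
      ≡⟨ ∑-cong (allFin ℓ) (λ j →
           trans (∑-cong (allFin m) (λ y → keepIf-comm (does (π₂ y ≟ c)) (does (π₁ j ≟ y)) (lookup M j)))
                 (∑-keepIf-≟ m (π₁ j) (λ y → keepIf (does (π₂ y ≟ c)) (lookup M j)))) ⟩
    ∑ (allFin ℓ) (λ j → keepIf (does (π₂ (π₁ j) ≟ c)) (lookup M j))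
      ≡⟨ sym (lookup-P (π₂ ∘ π₁) M c) ⟩
    lookup (P (π₂ ∘ π₁) M) c ∎
    where
    open ≡-Reasoning
    term : Fin o → Fin m → Fin ℓ → Vec ℚ d
    term c y j = keepIf (does (π₂ y ≟ c)) (keepIf (does (π₁ j ≟ y)) (lookup M j))

  P-cong-supp : {ℓ m : ℕ} (π π′ : Fin ℓ → Fin m) (M : Matrix ℓ d) →
                (∀ j → π j ≡ π′ j ⊎ lookup M j ≡ 𝟎) → P π M ≡ P π′ M
  P-cong-supp {ℓ} π π′ M agree = lookup-ext λ i →
    trans (lookup-P π M i) (trans (∑-cong (allFin ℓ) (term-cong i)) (sym (lookup-P π′ M i)))
    where
    term-cong : ∀ i j → keepIf (does (π j ≟ i)) (lookup M j) ≡ keepIf (does (π′ j ≟ i)) (lookup M j)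
    term-cong i j with agree j
    ... | inj₁ πj≡π′j = cong (λ z → keepIf (does (z ≟ i)) (lookup M j)) πj≡π′j
    ... | inj₂ Mj≡𝟎   rewrite Mj≡𝟎 = trans (keepIf-𝟎 _) (sym (keepIf-𝟎 _))

  P-cong : {ℓ m : ℕ} {π π′ : Fin ℓ → Fin m} (M : Matrix ℓ d) →
           (∀ j → π j ≡ π′ j) → P π M ≡ P π′ M
  P-cong M h = P-cong-supp _ _ M (inj₁ ∘ h)

  lookup-P-vanishes : {ℓ m : ℕ} (π : Fin ℓ → Fin m) (M : Matrix ℓ d) (i : Fin m) →
                      (∀ j → π j ≡ i → lookup M j ≡ 𝟎) → lookup (P π M) i ≡ 𝟎
  lookup-P-vanishes {ℓ} π M i h =
    trans (lookup-P π M i) (trans (∑-cong (allFin ℓ) term≡𝟎) (∑-𝟎 (allFin ℓ)))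
    where
    term≡𝟎 : ∀ j → keepIf (does (π j ≟ i)) (lookup M j) ≡ 𝟎
    term≡𝟎 j with π j ≟ i
    ... | yes πj≡i = h j πj≡i
    ... | no  _    = refl

  conic-row-vanishes : (𝓜 : LinearMinion d) → Conic 𝓜 → {ℓ m : ℕ} {M : Matrix ℓ d} → Mem 𝓜 ℓ M →
                       (π : Fin ℓ → Fin m) (i : Fin m) → lookup (P π M) i ≡ 𝟎 →
                       (j : Fin ℓ) → π j ≡ i → lookup M j ≡ 𝟎
  conic-row-vanishes 𝓜 conic {ℓ} {M = M} M∈𝓜 π i Pᵢ≡𝟎 j πj≡i =
    proj₂ conic ℓ M M∈𝓜 (λ j′ → does (π j′ ≟ i))
      (trans (sym (VP.lookup∘tabulate _ i)) Pᵢ≡𝟎) j (T-does (π j ≟ i) πj≡i)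

decode : {n k : ℕ} → Fin (n ^ k) → Vec (Fin n) k
decode {n} {zero}  _ = []
decode {n} {suc k} v = proj₁ (remQuot {n} (n ^ k) v) ∷ decode (proj₂ (remQuot {n} (n ^ k) v))

decode-enc : {n k : ℕ} (xs : Vec (Fin n) k) → decode (enc xs) ≡ xs
decode-enc []                      = refl
decode-enc {n} {suc k} (x ∷ xs) =
  cong₂ _∷_ (cong proj₁ split) (trans (cong (decode ∘ proj₂) split) (decode-enc xs))
  where split = FinP.remQuot-combine {k = n ^ k} x (enc xs)

enc-decode : {n k : ℕ} (v : Fin (n ^ k)) → enc {n} {k} (decode v) ≡ v
enc-decode {n} {zero}  zero = refl
enc-decode {n} {suc k} v =
  trans (cong (combine (proj₁ (remQuot {n} (n ^ k) v))) (enc-decode {n} {k} (proj₂ (remQuot {n} (n ^ k) v))))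
        (FinP.combine-remQuot {n} (n ^ k) v)

enc-injective : {n k : ℕ} (xs ys : Vec (Fin n) k) → enc xs ≡ enc ys → xs ≡ ys
enc-injective xs ys e = trans (sym (decode-enc xs)) (trans (cong decode e) (decode-enc ys))

allFin-+ : (p q : ℕ) → allFin (p + q) ≡ L.map (_↑ˡ q) (allFin p) ++ L.map (p ↑ʳ_) (allFin q)
allFin-+ zero    q = sym (LP.map-id (allFin q))
allFin-+ (suc p) q = cong (zero ∷_) (begin
  L.tabulate suc
    ≡⟨ sym (LP.map-tabulate id suc) ⟩
  L.map suc (allFin (p + q))
    ≡⟨ cong (L.map suc) (allFin-+ p q) ⟩
  L.map suc (L.map (_↑ˡ q) (allFin p) ++ L.map (p ↑ʳ_) (allFin q))
    ≡⟨ LP.map-++ suc (L.map (_↑ˡ q) (allFin p)) (L.map (p ↑ʳ_) (allFin q)) ⟩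
  L.map suc (L.map (_↑ˡ q) (allFin p)) ++ L.map suc (L.map (p ↑ʳ_) (allFin q))
    ≡⟨ cong₂ _++_ (trans (sym (LP.map-∘ (allFin p))) (trans (LP.map-∘ (allFin p))
                          (cong (L.map (_↑ˡ q)) (LP.map-tabulate id suc))))
                  (sym (LP.map-∘ (allFin q))) ⟩
  L.map (_↑ˡ q) (L.tabulate suc) ++ L.map (suc p ↑ʳ_) (allFin q) ∎)
  where open ≡-Reasoning

allFin-* : (m p : ℕ) → allFin (m * p) ≡ concatMap (λ x → L.map (combine x) (allFin p)) (allFin m)
allFin-* zero    p = refl
allFin-* (suc m) p = begin
  allFin (p + m * p)
    ≡⟨ allFin-+ p (m * p) ⟩
  L.map (_↑ˡ (m * p)) (allFin p) ++ L.map (p ↑ʳ_) (allFin (m * p))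
    ≡⟨ cong (L.map (_↑ˡ (m * p)) (allFin p) ++_) shifted ⟩
  concatMap (λ x → L.map (combine x) (allFin p)) (allFin (suc m)) ∎
  where
  open ≡-Reasoning
  block : Fin (suc m) → List (Fin (suc m * p))
  block x = L.map (combine x) (allFin p)
  shifted : L.map (p ↑ʳ_) (allFin (m * p)) ≡ concatMap block (L.tabulate suc)
  shifted = begin
    L.map (p ↑ʳ_) (allFin (m * p))
      ≡⟨ cong (L.map (p ↑ʳ_)) (allFin-* m p) ⟩
    L.map (p ↑ʳ_) (concatMap (λ x → L.map (combine x) (allFin p)) (allFin m))
      ≡⟨ LP.map-concatMap (p ↑ʳ_) _ (allFin m) ⟩
    concatMap (λ x → L.map (p ↑ʳ_) (L.map (combine x) (allFin p))) (allFin m)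
      ≡⟨ LP.concatMap-cong (λ x → sym (LP.map-∘ (allFin p))) (allFin m) ⟩
    concatMap (block ∘ suc) (allFin m)
      ≡⟨ sym (LP.concatMap-map block suc (allFin m)) ⟩
    concatMap block (L.map suc (allFin m))
      ≡⟨ cong (concatMap block) (LP.map-tabulate id suc) ⟩
    concatMap block (L.tabulate suc) ∎

map-enc-allVecs : (n k : ℕ) → L.map (enc {n} {k}) (allVecs n k) ≡ allFin (n ^ k)
map-enc-allVecs n zero    = refl
map-enc-allVecs n (suc k) = begin
  L.map enc (concatMap (λ x → L.map (x ∷_) (allVecs n k)) (allFin n))
    ≡⟨ LP.map-concatMap enc _ (allFin n) ⟩
  concatMap (λ x → L.map enc (L.map (x ∷_) (allVecs n k))) (allFin n)
    ≡⟨ LP.concatMap-cong (λ x → trans (sym (LP.map-∘ (allVecs n k)))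
                                      (trans (LP.map-∘ (allVecs n k)) (cong (L.map (combine x)) (map-enc-allVecs n k))))
                         (allFin n) ⟩
  concatMap (λ x → L.map (combine x) (allFin (n ^ k))) (allFin n)
    ≡⟨ sym (allFin-* n (n ^ k)) ⟩
  allFin (n ^ suc k) ∎
  where open ≡-Reasoning

-- Projections and tensoriality

project : {n k : ℕ} → Vec (Fin k) k → Fin (n ^ k) → Fin (n ^ k)
project {n} {k} is r = enc (V.map (lookup (decode {n} {k} r)) is)

lookup-decode-project : {n k : ℕ} (is : Vec (Fin k) k) (r : Fin (n ^ k)) (t : Fin k) →
                        lookup (decode {n} {k} (project is r)) t ≡ lookup (decode {n} {k} r) (lookup is t)
lookup-decode-project {n} {k} is r t =
  trans (cong (λ v → lookup v t) (decode-enc (V.map (lookup (decode {n} {k} r)) is))) (VP.lookup-map t _ is)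

projRow-P : {d n k : ℕ} (M : Matrix (n ^ k) d) (is : Vec (Fin k) k) (a : Vec (Fin n) k) →
            projRow M is a ≡ lookup (P (project is) M) (enc a)
projRow-P {d} {n} {k} M is a = begin
  projRow M is a
    ≡⟨ rowSum-filterᵇ (allVecs n k) _ _ ⟩
  ∑ (allVecs n k) (λ b → keepIf (does (V.map (lookup b) is ≡? a)) (lookup M (enc b)))
    ≡⟨ ∑-cong (allVecs n k) (λ b → cong (λ z → keepIf z (lookup M (enc b))) (same-test b)) ⟩
  ∑ (allVecs n k) (term ∘ enc)
    ≡⟨ sym (∑-map enc (allVecs n k) term) ⟩
  ∑ (L.map enc (allVecs n k)) term
    ≡⟨ cong (λ l → ∑ l term) (map-enc-allVecs n k) ⟩
  ∑ (allFin (n ^ k)) term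
    ≡⟨ sym (lookup-P (project is) M (enc a)) ⟩
  lookup (P (project is) M) (enc a) ∎
  where
  open ≡-Reasoning
  _≡?_ = VP.≡-dec _≟_
  term : Fin (n ^ k) → Vec ℚ d
  term r = keepIf (does (project is r ≟ enc a)) (lookup M r)
  same-test : ∀ b → does (V.map (lookup b) is ≡? a) ≡ does (project {n} is (enc b) ≟ enc a)
  same-test b rewrite decode-enc b =
    does-⇔ (mk⇔ (cong enc) (enc-injective _ a)) (V.map (lookup b) is ≡? a) (enc (V.map (lookup b) is) ≟ enc a)

CommutesWithProjections : {d : ℕ} (k : ℕ) (X A : Digraph) → (Fin (n X ^ k) → Matrix (n A ^ k) d) → Set
CommutesWithProjections k X A ξ =
  (x : Vec (Fin (n X)) k) (is : Vec (Fin k) k) → ξ (enc (V.map (lookup x) is)) ≡ P (project is) (ξ (enc x))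

module _ {d k : ℕ} (X A : Digraph) (ξ : Fin (n X ^ k) → Matrix (n A ^ k) d) where

  tensorial⇒commutes : IsTensorial k X A ξ → CommutesWithProjections k X A ξ
  tensorial⇒commutes tens x is = lookup-ext λ r → begin
    lookup (ξ (enc (V.map (lookup x) is))) r
      ≡⟨ cong (lookup (ξ (enc (V.map (lookup x) is)))) (sym (enc-decode {n A} {k} r)) ⟩
    lookup (ξ (enc (V.map (lookup x) is))) (enc (decode {n A} {k} r))
      ≡⟨ tens x is (decode {n A} {k} r) ⟩
    projRow (ξ (enc x)) is (decode {n A} {k} r)
      ≡⟨ projRow-P (ξ (enc x)) is (decode {n A} {k} r) ⟩
    lookup (P (project is) (ξ (enc x))) (enc (decode {n A} {k} r))
      ≡⟨ cong (lookup (P (project is) (ξ (enc x)))) (enc-decode {n A} {k} r) ⟩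
    lookup (P (project is) (ξ (enc x))) r ∎
    where open ≡-Reasoning

  commutes⇒tensorial : CommutesWithProjections k X A ξ → IsTensorial k X A ξ
  commutes⇒tensorial commutes x is a =
    trans (cong (λ M → lookup M (enc a)) (commutes x is)) (sym (projRow-P (ξ (enc x)) is a))

IsEdge : (D : Digraph) → Fin (n D) × Fin (n D) → Set
IsEdge D (a , b) = T (edge D a b)

module _ (D : Digraph) where

  private
    isEdge? : Fin (n D) × Fin (n D) → Bool
    isEdge? (a , b) = edge D a b

  edgeAt-isEdge : (e : Fin (#E D)) → IsEdge D (edgeAt D e)
  edgeAt-isEdge e = proj₂ (∈-filter⁻ (T? ∘ isEdge?) {xs = allPairs (n D)} (∈-lookup e))

  edgeAt-surjective : (a b : Fin (n D)) → T (edge D a b) → Σ (Fin (#E D)) λ e → edgeAt D e ≡ (a , b)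
  edgeAt-surjective a b a→b = Any.index ab∈edges , sym (lookup-index ab∈edges)
    where
    ab∈pairs : (a , b) ∈ allPairs (n D)
    ab∈pairs = ∈-concatMap⁺ (λ x → L.map (x ,_) (allFin (n D)))
                 (Any.map (λ { refl → ∈-map⁺ (a ,_) (∈-allFin b) }) (∈-allFin a))
    ab∈edges : (a , b) ∈ edges D
    ab∈edges = ∈-filter⁺ (T? ∘ isEdge?) ab∈pairs a→b

  indexOr : Fin (#E D) → Fin (n D) → Fin (n D) → Fin (#E D)
  indexOr e₀ a b with FinP.any? (λ e → ProdP.≡-dec _≟_ _≟_ (edgeAt D e) (a , b))
  ... | yes (e , _) = e
  ... | no  _       = e₀

  edgeAt-indexOr : (e₀ : Fin (#E D)) (a b : Fin (n D)) → T (edge D a b) → edgeAt D (indexOr e₀ a b) ≡ (a , b)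
  edgeAt-indexOr e₀ a b a→b with FinP.any? (λ e → ProdP.≡-dec _≟_ _≟_ (edgeAt D e) (a , b))
  ... | yes (_ , edgeAt≡ab) = edgeAt≡ab
  ... | no  ∄e              = ⊥-elim (∄e (edgeAt-surjective a b a→b))

-- Interleaving k pairs into a 2k-tuple

module _ {k : ℕ} where

  fstIx sndIx : Fin k → Fin (2 * k)
  fstIx j = j ↑ˡ (k + 0)
  sndIx j = k ↑ʳ (j ↑ˡ 0)

  flatten : {B : Set} → (Fin k → B × B) → Fin (2 * k) → B
  flatten c p with splitAt k p
  ... | inj₁ j = proj₁ (c j)
  ... | inj₂ q with splitAt k q
  ...   | inj₁ j = proj₂ (c j)
  ...   | inj₂ ()

  flatten-fstIx : {B : Set} (c : Fin k → B × B) (j : Fin k) → flatten c (fstIx j) ≡ proj₁ (c j)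
  flatten-fstIx c j rewrite FinP.splitAt-↑ˡ k j (k + 0) = refl

  flatten-sndIx : {B : Set} (c : Fin k → B × B) (j : Fin k) → flatten c (sndIx j) ≡ proj₂ (c j)
  flatten-sndIx c j rewrite FinP.splitAt-↑ʳ k (k + 0) (j ↑ˡ 0) | FinP.splitAt-↑ˡ k j 0 = refl

  flatten-natural : {B C : Set} (φ : B → C) {c : Fin k → B × B} {c′ : Fin k → C × C} →
                    (∀ j → c′ j ≡ (φ (proj₁ (c j)) , φ (proj₂ (c j)))) →
                    ∀ p → flatten c′ p ≡ φ (flatten c p)
  flatten-natural φ h p with splitAt k p
  ... | inj₁ j = cong proj₁ (h j)
  ... | inj₂ q with splitAt k q
  ...   | inj₁ j = cong proj₂ (h j)
  ...   | inj₂ ()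

  ixPair : Fin k → Fin (2 * k) × Fin (2 * k)
  ixPair j = fstIx j , sndIx j

  doubled : Vec (Fin k) k → Vec (Fin (2 * k)) (2 * k)
  doubled is = tabulate (flatten (ixPair ∘ lookup is))

  lookup-doubled : (is : Vec (Fin k) k) (p : Fin (2 * k)) → lookup (doubled is) p ≡ flatten (ixPair ∘ lookup is) p
  lookup-doubled is = VP.lookup∘tabulate (flatten (ixPair ∘ lookup is))

  lookup-doubled-fstIx : (is : Vec (Fin k) k) (j : Fin k) → lookup (doubled is) (fstIx j) ≡ fstIx (lookup is j)
  lookup-doubled-fstIx is j = trans (lookup-doubled is (fstIx j)) (flatten-fstIx (ixPair ∘ lookup is) j)

  lookup-doubled-sndIx : (is : Vec (Fin k) k) (j : Fin k) → lookup (doubled is) (sndIx j) ≡ sndIx (lookup is j)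
  lookup-doubled-sndIx is j = trans (lookup-doubled is (sndIx j)) (flatten-sndIx (ixPair ∘ lookup is) j)

-- Supports of tensorial homomorphisms

module _ {k : ℕ} where

  redirect : Fin k → Fin k → Fin k → Fin k
  redirect q p t with t ≟ q
  ... | yes _ = p
  ... | no  _ = t

  redirect-source : (q p : Fin k) → redirect q p q ≡ p
  redirect-source q p with q ≟ q
  ... | yes _   = refl
  ... | no  q≢q = ⊥-elim (q≢q refl)

  redirect-target : (q p : Fin k) → redirect q p p ≡ p
  redirect-target q p with p ≟ q
  ... | yes _ = refl
  ... | no  _ = refl

  lookup-redirect : {B : Set} (u : Vec B k) (q p : Fin k) → lookup u p ≡ lookup u q →
                    ∀ t → lookup u (redirect q p t) ≡ lookup u t
  lookup-redirect u q p up≡uq t with t ≟ q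
  ... | yes refl = up≡uq
  ... | no  _    = refl

module _ {d k : ℕ} (X A : Digraph) (ξ : Fin (n X ^ k) → Matrix (n A ^ k) d)
         (ξ-commutes : CommutesWithProjections k X A ξ) where

  rows-vanish-off-diagonal : (u : Vec (Fin (n X)) k) (p q : Fin k) → lookup u p ≡ lookup u q →
                             (r : Fin (n A ^ k)) → lookup (decode r) p ≢ lookup (decode r) q →
                             lookup (ξ (enc u)) r ≡ 𝟎
  rows-vanish-off-diagonal u p q up≡uq r bp≢bq = begin
    lookup (ξ (enc u)) r
      ≡⟨ cong (λ v → lookup (ξ (enc v)) r) (sym u∘collapse) ⟩
    lookup (ξ (enc (V.map (lookup u) collapse))) r
      ≡⟨ cong (λ M → lookup M r) (ξ-commutes u collapse) ⟩
    lookup (P (project collapse) (ξ (enc u))) r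
      ≡⟨ lookup-P-vanishes (project collapse) (ξ (enc u)) r (λ r′ e → ⊥-elim (bp≢bq (diagonal r′ e))) ⟩
    𝟎 ∎
    where
    open ≡-Reasoning
    collapse : Vec (Fin k) k
    collapse = tabulate (redirect q p)
    u∘collapse : V.map (lookup u) collapse ≡ u
    u∘collapse = lookup-ext λ t →
      trans (VP.lookup-map t (lookup u) collapse)
            (trans (cong (lookup u) (VP.lookup∘tabulate (redirect q p) t)) (lookup-redirect u q p up≡uq t))
    entry : (r′ : Fin (n A ^ k)) (t : Fin k) →
            lookup (decode (project {n A} collapse r′)) t ≡ lookup (decode r′) (redirect q p t)
    entry r′ t = trans (lookup-decode-project collapse r′ t)
                       (cong (lookup (decode r′)) (VP.lookup∘tabulate (redirect q p) t))
    diagonal : (r′ : Fin (n A ^ k)) → project collapse r′ ≡ r → lookup (decode r) p ≡ lookup (decode r) q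
    diagonal r′ refl = begin
      lookup (decode (project {n A} collapse r′)) p ≡⟨ entry r′ p ⟩
      lookup (decode r′) (redirect q p p)           ≡⟨ cong (lookup (decode r′)) p-and-q-both-go-to-p ⟩
      lookup (decode r′) (redirect q p q)           ≡⟨ sym (entry r′ q) ⟩
      lookup (decode (project {n A} collapse r′)) q ∎
      where p-and-q-both-go-to-p = trans (redirect-target q p) (sym (redirect-source q p))

module _ {d : ℕ} (𝓜 : LinearMinion d) (conic : Conic 𝓜) (X A : Digraph) {K′ : ℕ}
         {ξ : Fin (n X ^ suc (suc K′)) → Matrix (n A ^ suc (suc K′)) d}
         (hom : IsFreeHom 𝓜 (X ⊗ suc (suc K′)) (A ⊗ suc (suc K′)) ξ)
         (ξ-commutes : CommutesWithProjections (suc (suc K′)) X A ξ) where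

  -- Projecting onto (p, q, q, …, q) turns u into an entry of the hyperedge
  -- (u_p, u_q)^{⊗K}, whose rows lie over A-edges; conicity then passes the
  -- vanishing of the projected row back to every row of ξ(u) above it.
  rows-vanish-off-edges : (u : Vec (Fin (n X)) (suc (suc K′))) (p q : Fin (suc (suc K′))) →
                          T (edge X (lookup u p) (lookup u q)) →
                          (r : Fin (n A ^ suc (suc K′))) →
                          ¬ T (edge A (lookup (decode {n A} r) p) (lookup (decode {n A} r) q)) →
                          lookup (ξ (enc u)) r ≡ 𝟎
  rows-vanish-off-edges u p q up→uq r ¬bp→bq =
    conic-row-vanishes 𝓜 conic (proj₁ hom (enc u)) (project {n A} is) (enc a) projected-row r refl
    where
    b = decode {n A} {suc (suc K′)} r
    is = p ∷ replicate (suc K′) q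
    a = V.map (lookup b) is
    i₀ : Vec (Fin 2) (suc (suc K′))
    i₀ = zero ∷ replicate (suc K′) (suc zero)
    e = proj₁ (edgeAt-surjective X (lookup u p) (lookup u q) up→uq)
    edgeAt-e = proj₂ (edgeAt-surjective X (lookup u p) (lookup u q) up→uq)
    Q = proj₁ (proj₂ hom e)
    entA : Fin (#E A) → Fin (n A ^ suc (suc K′))
    entA g = ent (A ⊗ suc (suc K′)) g i₀
    u-is-entry : V.map (sel (edgeAt X e)) i₀ ≡ V.map (lookup u) is
    u-is-entry rewrite edgeAt-e =
      cong (lookup u p ∷_) (trans (VP.map-replicate _ _ (suc K′)) (sym (VP.map-replicate _ _ (suc K′))))
    projection-is-free : P (project {n A} is) (ξ (enc u)) ≡ P entA Q
    projection-is-free =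
      trans (sym (ξ-commutes u is)) (trans (cong (ξ ∘ enc) (sym u-is-entry)) (proj₂ (proj₂ (proj₂ hom e)) i₀))
    a-not-hit : ∀ g → entA g ≡ enc a → T (edge A (lookup b p) (lookup b q))
    a-not-hit g hit =
      subst (IsEdge A) (cong₂ _,_ (cong (λ v → lookup v zero) same) (cong (λ v → lookup v (suc zero)) same))
            (edgeAt-isEdge A g)
      where same = enc-injective (V.map (sel (edgeAt A g)) i₀) a hit
    projected-row : lookup (P (project {n A} is) (ξ (enc u))) (enc a) ≡ 𝟎
    projected-row = trans (cong (λ M → lookup M (enc a)) projection-is-free)
                          (lookup-P-vanishes entA Q (enc a) (λ g hit → ⊥-elim (¬bp→bq (a-not-hit g hit))))

-- The line-digraph construction

firstTwo : {k : ℕ} → Vec (Fin 2) (suc (suc k)) → Vec (Fin (suc (suc k))) (suc (suc k))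
firstTwo = V.map (sel (zero , suc zero))

map-lookup-firstTwo : {B : Set} {k : ℕ} (c : Vec B (suc (suc k))) (i : Vec (Fin 2) (suc (suc k))) →
                      V.map (lookup c) (firstTwo i) ≡ V.map (sel (lookup c zero , lookup c (suc zero))) i
map-lookup-firstTwo c i = trans (sym (VP.map-∘ (lookup c) _ i)) (VP.map-cong pick i)
  where
  pick : ∀ t → lookup c (sel (zero , suc zero) t) ≡ sel (lookup c zero , lookup c (suc zero)) t
  pick zero       = refl
  pick (suc zero) = refl

module LineDigraph {d : ℕ} (𝓜 : LinearMinion d) (conic : Conic 𝓜) (k′ : ℕ) (X A : Digraph)
  (ξ : Fin (n X ^ (2 * suc (suc k′))) → Matrix (n A ^ (2 * suc (suc k′))) d)
  (hom : IsFreeHom 𝓜 (X ⊗ (2 * suc (suc k′))) (A ⊗ (2 * suc (suc k′))) ξ)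
  (tens : IsTensorial (2 * suc (suc k′)) X A ξ)
  (e₀ : Fin (#E A)) (p₀ : Fin (#E (δ A))) where

  private
    k K : ℕ
    k = suc (suc k′)
    K = 2 * k

    decodeᴬ : Fin (n A ^ K) → Vec (Fin (n A)) K
    decodeᴬ = decode

    decodeᴱ : Fin (#E A ^ k) → Vec (Fin (#E A)) k
    decodeᴱ = decode

    projectᴬ : Vec (Fin K) K → Fin (n A ^ K) → Fin (n A ^ K)
    projectᴬ = project {n A}

    projectᴱ : Vec (Fin k) k → Fin (#E A ^ k) → Fin (#E A ^ k)
    projectᴱ = project {#E A}

  ξ-commutes : CommutesWithProjections K X A ξ
  ξ-commutes = tensorial⇒commutes X A ξ tens

  endpoints : Vec (Fin (#E X)) k → Vec (Fin (n X)) K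
  endpoints xs = tabulate (flatten (edgeAt X ∘ lookup xs))

  lookup-endpoints : (xs : Vec (Fin (#E X)) k) (p : Fin K) → lookup (endpoints xs) p ≡ flatten (edgeAt X ∘ lookup xs) p
  lookup-endpoints xs = VP.lookup∘tabulate (flatten (edgeAt X ∘ lookup xs))

  edgeAt-endpoints : (xs : Vec (Fin (#E X)) k) (j : Fin k) →
                     edgeAt X (lookup xs j) ≡ (lookup (endpoints xs) (fstIx j) , lookup (endpoints xs) (sndIx j))
  edgeAt-endpoints xs j = sym (cong₂ _,_
    (trans (lookup-endpoints xs (fstIx j)) (flatten-fstIx (edgeAt X ∘ lookup xs) j))
    (trans (lookup-endpoints xs (sndIx j)) (flatten-sndIx (edgeAt X ∘ lookup xs) j)))

  endpoints-map : (xs : Vec (Fin (#E X)) k) (is : Vec (Fin k) k) →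
                  endpoints (V.map (lookup xs) is) ≡ V.map (lookup (endpoints xs)) (doubled is)
  endpoints-map xs is = lookup-ext λ p → begin
    lookup (endpoints (V.map (lookup xs) is)) p
      ≡⟨ lookup-endpoints (V.map (lookup xs) is) p ⟩
    flatten (edgeAt X ∘ lookup (V.map (lookup xs) is)) p
      ≡⟨ flatten-natural (lookup (endpoints xs)) (λ j →
           trans (cong (edgeAt X) (VP.lookup-map j (lookup xs) is)) (edgeAt-endpoints xs (lookup is j))) p ⟩
    lookup (endpoints xs) (flatten (ixPair ∘ lookup is) p)
      ≡⟨ cong (lookup (endpoints xs)) (sym (lookup-doubled is p)) ⟩
    lookup (endpoints xs) (lookup (doubled is) p)
      ≡⟨ sym (VP.lookup-map p (lookup (endpoints xs)) (doubled is)) ⟩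
    lookup (V.map (lookup (endpoints xs)) (doubled is)) p ∎
    where open ≡-Reasoning

  edgesOf : Vec (Fin (n A)) K → Vec (Fin (#E A)) k
  edgesOf b = tabulate (λ j → indexOr A e₀ (lookup b (fstIx j)) (lookup b (sndIx j)))

  lookup-edgesOf : (b : Vec (Fin (n A)) K) (j : Fin k) →
                   lookup (edgesOf b) j ≡ indexOr A e₀ (lookup b (fstIx j)) (lookup b (sndIx j))
  lookup-edgesOf b = VP.lookup∘tabulate (λ j → indexOr A e₀ (lookup b (fstIx j)) (lookup b (sndIx j)))

  edgesOf-doubled : (b : Vec (Fin (n A)) K) (is : Vec (Fin k) k) →
                    edgesOf (V.map (lookup b) (doubled is)) ≡ V.map (lookup (edgesOf b)) is
  edgesOf-doubled b is = lookup-ext λ j → begin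
    lookup (edgesOf b′) j
      ≡⟨ lookup-edgesOf b′ j ⟩
    indexOr A e₀ (lookup b′ (fstIx j)) (lookup b′ (sndIx j))
      ≡⟨ cong₂ (indexOr A e₀)
           (trans (VP.lookup-map (fstIx j) (lookup b) (doubled is)) (cong (lookup b) (lookup-doubled-fstIx is j)))
           (trans (VP.lookup-map (sndIx j) (lookup b) (doubled is)) (cong (lookup b) (lookup-doubled-sndIx is j))) ⟩
    indexOr A e₀ (lookup b (fstIx (lookup is j))) (lookup b (sndIx (lookup is j)))
      ≡⟨ sym (lookup-edgesOf b (lookup is j)) ⟩
    lookup (edgesOf b) (lookup is j)
      ≡⟨ sym (VP.lookup-map j (lookup (edgesOf b)) is) ⟩
    lookup (V.map (lookup (edgesOf b)) is) j ∎
    where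
    open ≡-Reasoning
    b′ = V.map (lookup b) (doubled is)

  toEdges : Fin (n A ^ K) → Fin (#E A ^ k)
  toEdges r = enc (edgesOf (decodeᴬ r))

  toEdges-project : (is : Vec (Fin k) k) (r : Fin (n A ^ K)) →
                    toEdges (projectᴬ (doubled is) r) ≡ projectᴱ is (toEdges r)
  toEdges-project is r = begin
    enc (edgesOf (decodeᴬ (enc (V.map (lookup (decodeᴬ r)) (doubled is)))))
      ≡⟨ cong (enc ∘ edgesOf) (decode-enc (V.map (lookup (decodeᴬ r)) (doubled is))) ⟩
    enc (edgesOf (V.map (lookup (decodeᴬ r)) (doubled is)))
      ≡⟨ cong enc (edgesOf-doubled (decodeᴬ r) is) ⟩
    enc (V.map (lookup (edgesOf (decodeᴬ r))) is)
      ≡⟨ cong (λ v → enc (V.map (lookup v) is)) (sym (decode-enc (edgesOf (decodeᴬ r)))) ⟩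
    projectᴱ is (toEdges r) ∎
    where open ≡-Reasoning

  f : Fin (#E X ^ k) → Matrix (#E A ^ k) d
  f v = P toEdges (ξ (enc (endpoints (decode {#E X} {k} v))))

  f-enc : (xs : Vec (Fin (#E X)) k) → f (enc xs) ≡ P toEdges (ξ (enc (endpoints xs)))
  f-enc xs = cong (λ ys → P toEdges (ξ (enc (endpoints ys)))) (decode-enc xs)

  f-mem : (v : Fin (#E X ^ k)) → Mem 𝓜 (#E A ^ k) (f v)
  f-mem v = closed 𝓜 toEdges _ (proj₁ hom _)

  f-commutes : CommutesWithProjections k (δ X) (δ A) f
  f-commutes xs is = begin
    f (enc (V.map (lookup xs) is))
      ≡⟨ f-enc (V.map (lookup xs) is) ⟩
    P toEdges (ξ (enc (endpoints (V.map (lookup xs) is))))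
      ≡⟨ cong (λ ys → P toEdges (ξ (enc ys))) (endpoints-map xs is) ⟩
    P toEdges (ξ (enc (V.map (lookup (endpoints xs)) (doubled is))))
      ≡⟨ cong (P toEdges) (ξ-commutes (endpoints xs) (doubled is)) ⟩
    P toEdges (P (projectᴬ (doubled is)) M)
      ≡⟨ P-∘ (projectᴬ (doubled is)) toEdges M ⟩
    P (toEdges ∘ projectᴬ (doubled is)) M
      ≡⟨ P-cong M (toEdges-project is) ⟩
    P (projectᴱ is ∘ toEdges) M
      ≡⟨ sym (P-∘ toEdges (projectᴱ is) M) ⟩
    P (projectᴱ is) (P toEdges M)
      ≡⟨ cong (P (projectᴱ is)) (sym (f-enc xs)) ⟩
    P (projectᴱ is) (f (enc xs)) ∎
    where
    open ≡-Reasoning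
    M = ξ (enc (endpoints xs))

  FirstTwoAdjacent : Vec (Fin (#E A)) k → Set
  FirstTwoAdjacent c = T (edge (δ A) (lookup c zero) (lookup c (suc zero)))

  pathTuple : Fin (#E X) → Fin (#E X) → Vec (Fin (#E X)) k
  pathTuple e₁ e₂ = e₁ ∷ replicate (suc k′) e₂

  ξ-pathTuple-support : (e₁ e₂ : Fin (#E X)) → T (edge (δ X) e₁ e₂) → (r : Fin (n A ^ K)) →
                        lookup (ξ (enc (endpoints (pathTuple e₁ e₂)))) r ≡ 𝟎
                        ⊎ FirstTwoAdjacent (edgesOf (decodeᴬ r))
  ξ-pathTuple-support e₁ e₂ e₁→e₂ r =
    cases (T? (edge A (b q₀) (b q₁))) (T? (edge A (b q₂) (b q₃))) (b q₁ ≟ b q₂)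
    where
    open ≡-Reasoning
    b = lookup (decodeᴬ r)
    u = endpoints (pathTuple e₁ e₂)
    q₀ q₁ q₂ q₃ : Fin K
    q₀ = fstIx {k} zero
    q₁ = sndIx {k} zero
    q₂ = fstIx {k} (suc zero)
    q₃ = sndIx {k} (suc zero)
    u-edge : (j : Fin k) → T (edge X (lookup u (fstIx j)) (lookup u (sndIx j)))
    u-edge j = subst (IsEdge X) (edgeAt-endpoints (pathTuple e₁ e₂) j) (edgeAt-isEdge X (lookup (pathTuple e₁ e₂) j))
    u₁≡u₂ : lookup u q₁ ≡ lookup u q₂
    u₁≡u₂ = begin
      lookup u q₁             ≡⟨ sym (cong proj₂ (edgeAt-endpoints (pathTuple e₁ e₂) zero)) ⟩
      proj₂ (edgeAt X e₁)     ≡⟨ does-T (proj₂ (edgeAt X e₁) ≟ proj₁ (edgeAt X e₂)) e₁→e₂ ⟩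
      proj₁ (edgeAt X e₂)     ≡⟨ cong proj₁ (edgeAt-endpoints (pathTuple e₁ e₂) (suc zero)) ⟩
      lookup u q₂             ∎
    off-edges = rows-vanish-off-edges 𝓜 conic X A hom ξ-commutes u
    cases : Dec (T (edge A (b q₀) (b q₁))) → Dec (T (edge A (b q₂) (b q₃))) → Dec (b q₁ ≡ b q₂) →
            lookup (ξ (enc u)) r ≡ 𝟎
            ⊎ FirstTwoAdjacent (edgesOf (decodeᴬ r))
    cases (no ¬b₀→b₁) _ _ = inj₁ (off-edges q₀ q₁ (u-edge zero) r ¬b₀→b₁)
    cases (yes _) (no ¬b₂→b₃) _ = inj₁ (off-edges q₂ q₃ (u-edge (suc zero)) r ¬b₂→b₃)
    cases (yes _) (yes _) (no b₁≢b₂) = inj₁ (rows-vanish-off-diagonal X A ξ ξ-commutes u q₁ q₂ u₁≡u₂ r b₁≢b₂)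
    cases (yes b₀→b₁) (yes b₂→b₃) (yes b₁≡b₂) = inj₂ (T-does (_ ≟ _) (begin
        proj₂ (edgeAt A (indexOr A e₀ (b q₀) (b q₁))) ≡⟨ cong proj₂ (edgeAt-indexOr A e₀ _ _ b₀→b₁) ⟩
        b q₁                                          ≡⟨ b₁≡b₂ ⟩
        b q₂                                          ≡⟨ sym (cong proj₁ (edgeAt-indexOr A e₀ _ _ b₂→b₃)) ⟩
        proj₁ (edgeAt A (indexOr A e₀ (b q₂) (b q₃))) ∎))

  pairIndex : Fin (#E A ^ k) → Fin (#E (δ A))
  pairIndex s = indexOr (δ A) p₀ (lookup c zero) (lookup c (suc zero))
    where c = decodeᴱ s

  f-pathTuple-support : (e₁ e₂ : Fin (#E X)) → T (edge (δ X) e₁ e₂) → (i : Vec (Fin 2) k) (s : Fin (#E A ^ k)) →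
                        projectᴱ (firstTwo i) s ≡ ent ((δ A) ⊗ k) (pairIndex s) i
                        ⊎ lookup (f (enc (pathTuple e₁ e₂))) s ≡ 𝟎
  f-pathTuple-support e₁ e₂ e₁→e₂ i s
    with T? (edge (δ A) (lookup (decodeᴱ s) zero) (lookup (decodeᴱ s) (suc zero)))
  ... | yes c₀→c₁ = inj₁ (cong enc (begin
    V.map (lookup c) (firstTwo i)
      ≡⟨ map-lookup-firstTwo c i ⟩
    V.map (sel (lookup c zero , lookup c (suc zero))) i
      ≡⟨ cong (λ pr → V.map (sel pr) i) (sym (edgeAt-indexOr (δ A) p₀ _ _ c₀→c₁)) ⟩
    V.map (sel (edgeAt (δ A) (pairIndex s))) i ∎))
    where
    open ≡-Reasoning
    c = decodeᴱ s
  ... | no ¬c₀→c₁ = inj₂ (trans (cong (λ M → lookup M s) (f-enc (pathTuple e₁ e₂)))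
                                (lookup-P-vanishes toEdges (ξ (enc (endpoints (pathTuple e₁ e₂)))) s row-vanishes))
    where
    row-vanishes : ∀ r → toEdges r ≡ s → lookup (ξ (enc (endpoints (pathTuple e₁ e₂)))) r ≡ 𝟎
    row-vanishes r refl = [ id , (λ c₀→c₁ → ⊥-elim (¬c₀→c₁ (subst FirstTwoAdjacent (sym decode-s) c₀→c₁))) ]′
                            (ξ-pathTuple-support e₁ e₂ e₁→e₂ r)
      where decode-s = decode-enc (edgesOf (decodeᴬ r))

  pathEdge : (e : Fin (#E (δ X))) → FreeEdge 𝓜 ((δ A) ⊗ k) (λ i → f (ent ((δ X) ⊗ k) e i))
  pathEdge e = P pairIndex F , closed 𝓜 pairIndex F (f-mem _) , λ i → begin
    f (enc (V.map (sel (e₁ , e₂)) i))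
      ≡⟨ cong (f ∘ enc) (sym (map-lookup-firstTwo (pathTuple e₁ e₂) i)) ⟩
    f (enc (V.map (lookup (pathTuple e₁ e₂)) (firstTwo i)))
      ≡⟨ f-commutes (pathTuple e₁ e₂) (firstTwo i) ⟩
    P (projectᴱ (firstTwo i)) F
      ≡⟨ P-cong-supp _ _ F (f-pathTuple-support e₁ e₂ (edgeAt-isEdge (δ X) e) i) ⟩
    P (entAt i ∘ pairIndex) F
      ≡⟨ sym (P-∘ pairIndex (entAt i) F) ⟩
    P (entAt i) (P pairIndex F) ∎
    where
    open ≡-Reasoning
    e₁ = proj₁ (edgeAt (δ X) e)
    e₂ = proj₂ (edgeAt (δ X) e)
    F = f (enc (pathTuple e₁ e₂))
    entAt : Vec (Fin 2) k → Fin (#E (δ A)) → Fin (#E A ^ k)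
    entAt i g = ent ((δ A) ⊗ k) g i

  tensorialHom : TensorialHom 𝓜 k (δ X) (δ A)
  tensorialHom = f , (f-mem , pathEdge) , commutes⇒tensorial (δ X) (δ A) f f-commutes

proposition6p2 : {d : ℕ} (𝓜 : LinearMinion d) → Conic 𝓜 →
    (k : ℕ) → 2 ≤ k → (X A : Digraph) →
    TensorialHom 𝓜 (2 * k) X A → HasEdge (δ A) →
    TensorialHom 𝓜 k (δ X) (δ A)
proposition6p2 𝓜 conic (suc (suc k′)) (s≤s (s≤s z≤n)) X A (ξ , hom , tens) (e₀ , e₁ , e₀→e₁) =
  LineDigraph.tensorialHom 𝓜 conic k′ X A ξ hom tens e₀ (proj₁ (edgeAt-surjective (δ A) e₀ e₁ e₀→e₁))
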